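{- Let $T$ be a tree and $u\in V(T)$ with $d_T(u)\ge 3$ such that $u$ is adjacent to a leaf $v$. Let $T'$ be a tree obtained by smoothing $u$ in $T-v$. Then $b(T)\le b(T')+1$. More precisely, $T$ has a burning sequence of length at most $b(T')+1$ whose first vertex is $v$.
   Context: All graphs are finite and simple. For a connected graph $G$, a burning process is defined as follows: initially all vertices are unburned; in each round $r\ge 1$ one chooses an unburned vertex $x_r$ (the source of round $r$), and then burns $x_r$ together with every unburned vertex adjacent to a vertex that was already burned. Burned vertices stay burned, and the process terminates when all vertices are burned. If it terminates after $k$ rounds, $(x_1,\dots,x_k)$ is a burning sequence of length $k$. The burning number $b(G)$ is the minimum length of a burning sequence for $G$. Smoothing: let $T$ be a tree and $w\in V(T)$ with $N_T(w)=\{w_1,\dots,w_q\}$, $q\ge 2$, where exactly $p\ge 0$ of these neighbours are leaves of $T$, labelled $w_1,\dots,w_p$. A tree obtained by smoothing $w$ in $T$ is formed from $T$ by deleting $w$ and then: (1) if $p\le 2$, adding the edges of the path $w_1w_3w_4\cdots w_qw_2$; (2) if $p\ge 3$, also deleting $w_3,\dots,w_p$ and adding the edges of the path $w_1w_{p+1}w_{p+2}\cdots w_qw_2$. Since the labelling is not unique, the resulting tree need not be unique. -}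

module Defs where

open import Data.Nat using (ℕ; zero; suc; _≤_)
open import Data.Bool using (Bool; true; false; _∧_; _∨_; not; if_then_else_; T)
open import Data.Fin using (Fin; _≟_)
open import Data.List using (List; []; _∷_; _++_; [_]; length; map; allFin)
open import Data.Nat.ListAction using (sum)
open import Data.Bool.ListAction using (any)
open import Data.List.Relation.Unary.All using (All)
open import Data.List.Relation.Unary.Linked using (Linked)
open import Data.List.Relation.Unary.Unique.Propositional using (Unique)
open import Data.List.Membership.Propositional using (_∈_)
open import Data.Product using (Σ; _×_; ∃)
open import Relation.Nullary using (¬_)
open import Relation.Nullary.Decidable using (⌊_⌋)
open import Relation.Binary.PropositionalEquality using (_≡_)
open import Relation.Binary.Construct.Closure.ReflexiveTransitive using (Star)

-- A graph whose vertex set is a subset of Fin n: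
-- V x = true iff x is a vertex; E x y = true iff xy is an edge.
record Graph (n : ℕ) : Set where
  field
    V : Fin n → Bool
    E : Fin n → Fin n → Bool
open Graph public

_==_ : ∀ {n} → Fin n → Fin n → Bool
x == y = ⌊ x ≟ y ⌋

Adj : ∀ {n} → Graph n → Fin n → Fin n → Set
Adj G x y = T (E G x y)

IsSimple : ∀ {n} → Graph n → Set
IsSimple {n} G =
  (∀ x y → Adj G x y → Adj G y x) ×
  (∀ x → ¬ Adj G x x) ×
  (∀ x y → Adj G x y → T (V G x))

IsConnected : ∀ {n} → Graph n → Set
IsConnected {n} G = ∀ (x y : Fin n) → T (V G x) → T (V G y) → Star (Adj G) x y

-- a cycle x₀ x₁ … x_{k-1} x₀ with k ≥ 3 distinct vertices
IsCycle : ∀ {n} → Graph n → Fin n → List (Fin n) → Set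
IsCycle G x xs = Unique (x ∷ xs) × (2 ≤ length xs) × Linked (Adj G) ((x ∷ xs) ++ [ x ])

IsAcyclic : ∀ {n} → Graph n → Set
IsAcyclic {n} G = ∀ (x : Fin n) (xs : List (Fin n)) → ¬ IsCycle G x xs

IsTree : ∀ {n} → Graph n → Set
IsTree G = IsSimple G × IsConnected G × IsAcyclic G

deg : ∀ {n} → Graph n → Fin n → ℕ
deg {n} G x = sum (map (λ y → if E G x y then 1 else 0) (allFin n))

IsLeaf : ∀ {n} → Graph n → Fin n → Set
IsLeaf G x = deg G x ≡ 1

deleteVertex : ∀ {n} → Graph n → Fin n → Graph n
deleteVertex G v = record
  { V = λ x → V G x ∧ not (x == v)
  ; E = λ x y → E G x y ∧ not (x == v) ∧ not (y == v) }

-- Smoothing.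
-- A labelling of N_S(w) is given by two lists: ls = w₁ … w_p (the leaf
-- neighbours) and ns = w_{p+1} … w_q (the non-leaf neighbours).

IsSmoothingLabelling : ∀ {n} → Graph n → Fin n → List (Fin n) → List (Fin n) → Set
IsSmoothingLabelling {n} S w ls ns =
  T (V S w) ×
  Unique (ls ++ ns) ×
  (∀ (y : Fin n) → (y ∈ (ls ++ ns) → Adj S w y) × (Adj S w y → y ∈ (ls ++ ns))) ×
  (2 ≤ length (ls ++ ns)) ×
  All (IsLeaf S) ls ×
  All (λ y → ¬ IsLeaf S y) ns

pathLE : ∀ {n} → List (Fin n) → List (Fin n)
pathLE (a ∷ b ∷ rest) = a ∷ (rest ++ [ b ])
pathLE _ = []

smoothPath : ∀ {n} → List (Fin n) → List (Fin n) → List (Fin n)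
smoothPath (a ∷ b ∷ c ∷ cs) ns = a ∷ (ns ++ [ b ])
smoothPath ls ns = pathLE (ls ++ ns)

smoothDeleted : ∀ {n} → List (Fin n) → List (Fin n)
smoothDeleted (a ∷ b ∷ c ∷ cs) = c ∷ cs
smoothDeleted ls = []

pathAdj : ∀ {n} → List (Fin n) → Fin n → Fin n → Bool
pathAdj (a ∷ b ∷ rest) x y =
  ((x == a) ∧ (y == b)) ∨ ((x == b) ∧ (y == a)) ∨ pathAdj (b ∷ rest) x y
pathAdj _ x y = false

smooth : ∀ {n} → Graph n → Fin n → List (Fin n) → List (Fin n) → Graph n
smooth {n} S w ls ns = record { V = V' ; E = E' }
  where
  V' : Fin n → Bool
  V' x = V S x ∧ not (x == w) ∧ not (any (x ==_) (smoothDeleted ls))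
  E' : Fin n → Fin n → Bool
  E' x y = V' x ∧ V' y ∧ (E S x y ∨ pathAdj (smoothPath ls ns) x y)

burnStep : ∀ {n} → Graph n → (Fin n → Bool) → Fin n → (Fin n → Bool)
burnStep {n} G B x y =
  B y ∨ (y == x) ∨ any (λ z → E G z y ∧ B z) (allFin n)

BurnsFrom : ∀ {n} → Graph n → (Fin n → Bool) → List (Fin n) → Set
BurnsFrom G B [] = ∀ y → T (V G y) → T (B y)
BurnsFrom G B (x ∷ xs) = T (V G x) × T (not (B x)) × BurnsFrom G (burnStep G B x) xs

IsBurningSequence : ∀ {n} → Graph n → List (Fin n) → Set
IsBurningSequence G xs = BurnsFrom G (λ _ → false) xs

IsBurningNumber : ∀ {n} → Graph n → ℕ → Set
IsBurningNumber {n} G b =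
  (Σ (List (Fin n)) λ xs → IsBurningSequence G xs × length xs ≡ b) ×
  (∀ (xs : List (Fin n)) → IsBurningSequence G xs → b ≤ length xs)

-- Burn v first; then u burns one round later and all of N(u) one round after that.
-- Every vertex of T lies in T′ or in N[u], and every edge of T′ is an edge of T or ends
-- in N(u), because the added path only joins neighbours of u. Replaying a burning sequence
-- of T′ in T after v (replacing a source that already burns by any unburnt vertex) therefore
-- keeps the burnt set of T′ inside that of T: fire can only cross an added edge once T′ has a
-- burning vertex, by which time u burns in T. Since T′ has two vertices, its sequence has at
-- least two rounds, so at the end N[u] is burnt as well.

{-# OPTIONS --safe #-}
module Submission where

open import Defs
open import Data.Nat using (ℕ; suc; _≤_; _+_; z≤n; s≤s)
open import Data.Nat.Properties using (≤-trans; +-suc)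
open import Data.Bool using (Bool; true; false; not; _∧_; T)
open import Data.Bool.Properties using (T-∧; T-∨)
open import Data.Bool.ListAction using (any)
open import Data.Fin using (Fin; _≟_)
open import Data.Fin.Properties using (any?)
open import Data.List using (List; []; _∷_; _++_; length; drop; allFin)
open import Data.List.Membership.Propositional using (_∈_; _∉_; lose)
open import Data.List.Membership.Propositional.Properties using (∈-allFin; ∈-++⁺ˡ; ∈-++⁺ʳ; ∈-++⁻)
open import Data.List.Relation.Unary.Any as Any using (here; there; satisfied)
open import Data.List.Relation.Unary.Any.Properties using (any⁺; any⁻)
open import Data.List.Relation.Unary.All using (_∷_)
open import Data.List.Relation.Unary.All.Properties using (All¬⇒¬Any)
open import Data.List.Relation.Unary.AllPairs using (_∷_)
open import Data.List.Relation.Unary.Unique.Propositional using (Unique)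
open import Data.Product using (Σ; _×_; _,_; proj₁; proj₂; ∃₂; ∃-syntax)
open import Data.Sum as Sum using (_⊎_; inj₁; inj₂; [_,_])
open import Data.Unit using (tt)
open import Data.Empty using (⊥-elim)
open import Function using (_∘_)
open import Function.Bundles using (Equivalence)
open import Relation.Nullary using (¬_; yes; no; contradiction)
open import Relation.Nullary.Decidable using (T?; toWitness; fromWitness; fromWitnessFalse; decidable-stable)
open import Relation.Unary using (Pred; _⊆_; Empty)
open import Relation.Binary.PropositionalEquality using (_≡_; _≢_; refl; sym; trans; subst)
open import Level using (0ℓ)

open Equivalence using (to; from)

¬T⇒T-not : ∀ {b} → ¬ T b → T (not b)
¬T⇒T-not {false} _   = tt
¬T⇒T-not {true}  ¬tt = ¬tt tt

module _ {n : ℕ} where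

  ⟦_⟧ : (Fin n → Bool) → Pred (Fin n) 0ℓ
  ⟦ B ⟧ y = T (B y)

  AllBurnt : Graph n → (Fin n → Bool) → Set
  AllBurnt G B = ∀ y → T (V G y) → T (B y)

  N[_,_]⊆_ : Graph n → (B B⁺ : Fin n → Bool) → Set
  N[ G , B ]⊆ B⁺ = ⟦ B ⟧ ⊆ ⟦ B⁺ ⟧ × (∀ {z y} → Adj G z y → T (B z) → T (B⁺ y))

  HasTwoVertices : Graph n → Set
  HasTwoVertices G = ∃₂ λ a b → a ≢ b × T (V G a) × T (V G b)

  module _ (G : Graph n) (B : Fin n → Bool) where

    private
      burningNeighbour : Fin n → Fin n → Bool
      burningNeighbour y z = E G z y ∧ B z

    N⊆burnStep : ∀ x → N[ G , B ]⊆ burnStep G B x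
    N⊆burnStep x = (λ {y} y∈B → from (T-∨ {B y}) (inj₁ y∈B))
                   , λ {z} {y} zy z∈B → from (T-∨ {B y}) (inj₂ (from (T-∨ {y == x}) (inj₂
                       (any⁺ (burningNeighbour y) (lose (∈-allFin z) (from T-∧ (zy , z∈B)))))))

    burnStep-source : ∀ x → T (burnStep G B x x)
    burnStep-source x = from (T-∨ {B x}) (inj₂ (from (T-∨ {x == x}) (inj₁ (fromWitness refl))))

    burnStep-least : ∀ {B⁺ x} → N[ G , B ]⊆ B⁺ → T (B⁺ x) → ⟦ burnStep G B x ⟧ ⊆ ⟦ B⁺ ⟧
    burnStep-least {B⁺} {x} (B⊆B⁺ , spread) x∈B⁺ {y} h with to (T-∨ {B y}) h
    ... | inj₁ y∈B = B⊆B⁺ y∈B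
    ... | inj₂ h′ with to (T-∨ {y == x}) h′
    ...   | inj₁ y≡x = subst ⟦ B⁺ ⟧ (sym (toWitness y≡x)) x∈B⁺
    ...   | inj₂ h″ with satisfied (any⁻ (burningNeighbour y) (allFin n) h″)
    ...     | _ , zy∧z∈B = let zy , z∈B = to T-∧ zy∧z∈B in spread zy z∈B

    -- If the prescribed source x is already burning, any unburnt vertex serves as the source instead.
    nextSource : ∀ {x} → T (V G x) →
      AllBurnt G B ⊎ ∃[ y ] T (V G y) × T (not (B y)) × T (burnStep G B y x)
    nextSource {x} x∈G with T? (B x)
    ... | no x∉B = inj₂ (x , x∈G , ¬T⇒T-not x∉B , burnStep-source x)
    ... | yes x∈B with any? (λ y → T? (V G y ∧ not (B y)))
    ...   | yes (y , h) = let y∈G , y∉B = to T-∧ h in inj₂ (y , y∈G , y∉B , proj₁ (N⊆burnStep y) x∈B)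
    ...   | no none = inj₁ λ y y∈G → decidable-stable (T? (B y))
                          λ y∉B → none (y , from T-∧ (y∈G , ¬T⇒T-not y∉B))

  burnStep-∅ : ∀ G {x y} → T (burnStep G (λ _ → false) x y) → y ≡ x
  burnStep-∅ G {x} h =
    toWitness (burnStep-least G (λ _ → false) {B⁺ = _== x} ((λ ()) , λ _ ()) (fromWitness refl) h)

  burningSequence-2≤length : ∀ {G xs} → HasTwoVertices G → IsBurningSequence G xs → 2 ≤ length xs
  burningSequence-2≤length {xs = []} (a , _ , _ , a∈G , _) burnt = ⊥-elim (burnt a a∈G)
  burningSequence-2≤length {G} {xs = _ ∷ []} (a , b , a≢b , a∈G , b∈G) (_ , _ , burnt) =
    contradiction (trans (burnStep-∅ G (burnt a a∈G)) (sym (burnStep-∅ G (burnt b b∈G)))) a≢b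
  burningSequence-2≤length {xs = _ ∷ _ ∷ _} _ _ = s≤s (s≤s z≤n)

record HubReduction {n} (G H : Graph n) (u v : Fin n) : Set where
  field
    source∈G  : T (V G v)
    source~u  : Adj G v u
    vertices⊆ : ∀ {y} → T (V H y) → T (V G y)
    edge      : ∀ {z y} → Adj H z y → Adj G z y ⊎ Adj G u y
    cover     : ∀ {y} → T (V G y) → T (V H y) ⊎ y ≡ u ⊎ Adj G u y

module HubSimulation {n} {G H : Graph n} {u v : Fin n} (hub : HubReduction G H u v) where
  open HubReduction hub

  -- B: G-burnt set after the round with source v and t further rounds; B′: H-burnt set after t rounds.
  data Ahead : ℕ → (B B′ : Fin n → Bool) → Set where
    v-burnt    : ∀ {B B′} → T (B v) → Empty ⟦ B′ ⟧ → Ahead 0 B B′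
    u-burnt    : ∀ {B B′} → T (B u) → ⟦ B′ ⟧ ⊆ ⟦ B ⟧ → Ahead 1 B B′
    N[u]-burnt : ∀ {t B B′} → T (B u) → Adj G u ⊆ ⟦ B ⟧ → ⟦ B′ ⟧ ⊆ ⟦ B ⟧ → Ahead (2 + t) B B′

  -- Once u burns in G, every H-edge leaving B′ ends in N_G[B]: it is a G-edge or ends in N_G(u).
  ahead-step-u-burnt : ∀ {t B B′ B⁺ x} → T (B u) → ⟦ B′ ⟧ ⊆ ⟦ B ⟧ → N[ G , B ]⊆ B⁺ → T (B⁺ x) →
                       Ahead (2 + t) B⁺ (burnStep H B′ x)
  ahead-step-u-burnt {B′ = B′} u∈B B′⊆B (B⊆B⁺ , spread) x∈B⁺ =
    N[u]-burnt (B⊆B⁺ u∈B) (λ uy → spread uy u∈B) (burnStep-least H B′ (B⊆B⁺ ∘ B′⊆B , spreadᴴ) x∈B⁺)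
    where
    spreadᴴ : ∀ {z y} → Adj H z y → T (B′ z) → T _
    spreadᴴ zy z∈B′ = [ (λ zyᴳ → spread zyᴳ (B′⊆B z∈B′)) , (λ uy → spread uy u∈B) ] (edge zy)

  ahead-step : ∀ {t B B′ B⁺ x} → Ahead t B B′ → N[ G , B ]⊆ B⁺ → T (B⁺ x) →
               Ahead (suc t) B⁺ (burnStep H B′ x)
  ahead-step {B′ = B′} (v-burnt v∈B B′-empty) (_ , spread) x∈B⁺ =
    u-burnt (spread source~u v∈B) (burnStep-least H B′ (⊥-elim ∘ B′-empty _ , λ _ → ⊥-elim ∘ B′-empty _) x∈B⁺)
  ahead-step (u-burnt u∈B B′⊆B)      = ahead-step-u-burnt u∈B B′⊆B
  ahead-step (N[u]-burnt u∈B _ B′⊆B) = ahead-step-u-burnt u∈B B′⊆B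

  ahead-allBurnt : ∀ {t B B′} → Ahead (2 + t) B B′ → AllBurnt H B′ → AllBurnt G B
  ahead-allBurnt (N[u]-burnt u∈B N⊆B B′⊆B) H-burnt y y∈G with cover y∈G
  ... | inj₁ y∈H         = B′⊆B (H-burnt y y∈H)
  ... | inj₂ (inj₁ refl) = u∈B
  ... | inj₂ (inj₂ uy)   = N⊆B uy

  simulate : ∀ {t B B′} → Ahead t B B′ → ∀ xs′ → BurnsFrom H B′ xs′ → 2 ≤ t + length xs′ →
             ∃[ xs ] BurnsFrom G B xs × length xs ≤ length xs′
  simulate ahead@(N[u]-burnt _ _ _) [] H-burnt _ = [] , ahead-allBurnt ahead H-burnt , z≤n
  simulate {t} {B} ahead (x ∷ xs′) (x∈H , _ , H-burns) 2≤ with nextSource G B (vertices⊆ x∈H)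
  ... | inj₁ G-burnt = [] , G-burnt , z≤n
  ... | inj₂ (y , y∈G , y∉B , x∈B⁺) =
    let xs , G-burns , len = simulate (ahead-step ahead (N⊆burnStep G B y) x∈B⁺) xs′ H-burns
                                      (subst (2 ≤_) (+-suc t (length xs′)) 2≤)
    in y ∷ xs , (y∈G , y∉B , G-burns) , s≤s len
  simulate (v-burnt _ _) [] _ ()
  simulate (u-burnt _ _) [] _ (s≤s ())

  burningSequence-lift : ∀ {xs′} → IsBurningSequence H xs′ → 2 ≤ length xs′ →
               ∃[ xs ] IsBurningSequence G (v ∷ xs) × length xs ≤ length xs′
  burningSequence-lift H-burns 2≤ =
    let xs , G-burns , len = simulate (v-burnt (burnStep-source G (λ _ → false) v) λ _ ()) _ H-burns 2≤
    in xs , (source∈G , tt , G-burns) , len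

open HubSimulation using (burningSequence-lift)

leadingPair : ∀ {A : Set} (xs : List A) → Unique xs → 2 ≤ length xs →
  ∃₂ λ a b → a ≢ b × a ∈ xs × b ∈ xs × a ∉ drop 2 xs × b ∉ drop 2 xs
leadingPair (a ∷ b ∷ _) ((a≢b ∷ a∉) ∷ (b∉ ∷ _)) _ =
  a , b , a≢b , here refl , there (here refl) , All¬⇒¬Any a∉ , All¬⇒¬Any b∉
leadingPair (_ ∷ []) _ (s≤s ())

module _ {n : ℕ} where

  any==⇒∈ : ∀ {y : Fin n} xs → T (any (y ==_) xs) → y ∈ xs
  any==⇒∈ xs = Any.map toWitness ∘ any⁻ _ xs

  pathAdj⇒∈ : ∀ (P : List (Fin n)) {z y} → T (pathAdj P z y) → y ∈ P
  pathAdj⇒∈ (a ∷ P@(b ∷ _)) {z} {y} =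
    [ there ∘ here ∘ toWitness ∘ proj₂ ∘ to (T-∧ {z == a})
    , [ here ∘ toWitness ∘ proj₂ ∘ to (T-∧ {z == b}) , there ∘ pathAdj⇒∈ P ] ∘ to (T-∨ {(z == b) ∧ (y == a)})
    ] ∘ to (T-∨ {(z == a) ∧ (y == b)})

  pathLE⊆ : ∀ (xs : List (Fin n)) {y} → y ∈ pathLE xs → y ∈ xs
  pathLE⊆ (a ∷ b ∷ rest) (here y≡a) = here y≡a
  pathLE⊆ (a ∷ b ∷ rest) (there y∈) with ∈-++⁻ rest y∈
  ... | inj₁ y∈rest     = there (there y∈rest)
  ... | inj₂ (here y≡b) = there (here y≡b)

  smoothPath⊆ : ∀ (ls ns : List (Fin n)) {y} → y ∈ smoothPath ls ns → y ∈ ls ++ ns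
  smoothPath⊆ (a ∷ b ∷ c ∷ cs) ns y∈ with pathLE⊆ (a ∷ b ∷ ns) y∈
  ... | here y≡a           = here y≡a
  ... | there (here y≡b)   = there (here y≡b)
  ... | there (there y∈ns) = there (there (∈-++⁺ʳ (c ∷ cs) y∈ns))
  smoothPath⊆ []           ns = pathLE⊆ ns
  smoothPath⊆ (a ∷ [])     ns = pathLE⊆ (a ∷ ns)
  smoothPath⊆ (a ∷ b ∷ []) ns = pathLE⊆ (a ∷ b ∷ ns)

  smoothDeleted⊆ : ∀ (ls : List (Fin n)) {y} → y ∈ smoothDeleted ls → y ∈ ls
  smoothDeleted⊆ (_ ∷ _ ∷ _ ∷ _) = there ∘ there

  smoothDeleted⊆drop2 : ∀ (ls ns : List (Fin n)) {y} → y ∈ smoothDeleted ls → y ∈ drop 2 (ls ++ ns)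
  smoothDeleted⊆drop2 (_ ∷ _ ∷ _ ∷ _) _ = ∈-++⁺ˡ

module VertexDeletion {n} (G : Graph n) (v : Fin n) where

  deleteVertex-V⊆ : ∀ {y} → T (V (deleteVertex G v) y) → T (V G y)
  deleteVertex-V⊆ = proj₁ ∘ to T-∧

  deleteVertex-Adj⊆ : ∀ {x y} → Adj (deleteVertex G v) x y → Adj G x y
  deleteVertex-Adj⊆ = proj₁ ∘ to T-∧

  deleteVertex-V : ∀ {y} → T (V G y) → T (V (deleteVertex G v) y) ⊎ y ≡ v
  deleteVertex-V {y} y∈G with y ≟ v
  ... | yes y≡v = inj₂ y≡v
  ... | no _    = inj₁ (from T-∧ (y∈G , tt))

  deleteVertex-simple : IsSimple G → IsSimple (deleteVertex G v)
  deleteVertex-simple (symmetric , loopless , Adj⇒V) =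
    symmetric′ , (λ x → loopless x ∘ deleteVertex-Adj⊆) , Adj⇒V′
    where
    symmetric′ : ∀ x y → Adj (deleteVertex G v) x y → Adj (deleteVertex G v) y x
    symmetric′ x y xy with to T-∧ xy
    ... | xyᴳ , x≢v∧y≢v with to (T-∧ {not (x == v)}) x≢v∧y≢v
    ...   | x≢v , y≢v = from T-∧ (symmetric x y xyᴳ , from T-∧ (y≢v , x≢v))
    Adj⇒V′ : ∀ x y → Adj (deleteVertex G v) x y → T (V (deleteVertex G v) x)
    Adj⇒V′ x y xy with to T-∧ xy
    ... | xyᴳ , x≢v∧y≢v = from T-∧ (Adj⇒V x y xyᴳ , proj₁ (to (T-∧ {not (x == v)}) x≢v∧y≢v))

module Smoothing {n} (S : Graph n) (w : Fin n) (ls ns : List (Fin n)) where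

  labelled⇒Adj : IsSmoothingLabelling S w ls ns → ∀ {y} → y ∈ ls ++ ns → Adj S w y
  labelled⇒Adj (_ , _ , nbhd , _) {y} = proj₁ (nbhd y)

  smooth-V⊆ : ∀ {y} → T (V (smooth S w ls ns) y) → T (V S y)
  smooth-V⊆ = proj₁ ∘ to T-∧

  smooth-V : ∀ {y} → T (V S y) → T (V (smooth S w ls ns) y) ⊎ y ≡ w ⊎ y ∈ smoothDeleted ls
  smooth-V {y} y∈S with y ≟ w | T? (any (y ==_) (smoothDeleted ls))
  ... | yes y≡w | _         = inj₂ (inj₁ y≡w)
  ... | no _    | yes y∈del = inj₂ (inj₂ (any==⇒∈ _ y∈del))
  ... | no _    | no y∉del  = inj₁ (from T-∧ (y∈S , from T-∧ (tt , ¬T⇒T-not y∉del)))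

  smooth-Adj : IsSmoothingLabelling S w ls ns → ∀ {z y} → Adj (smooth S w ls ns) z y → Adj S z y ⊎ Adj S w y
  smooth-Adj lab {z} {y} zy with to (T-∧ {V (smooth S w ls ns) z}) zy
  ... | _ , zy′ with to (T-∧ {V (smooth S w ls ns) y}) zy′
  ...   | _ , zyˢ∨onPath =
    Sum.map₂ (labelled⇒Adj lab ∘ smoothPath⊆ ls ns ∘ pathAdj⇒∈ _) (to (T-∨ {E S z y}) zyˢ∨onPath)

  smooth-vertex : IsSimple S → IsSmoothingLabelling S w ls ns →
                  ∀ {y} → y ∈ ls ++ ns → y ∉ smoothDeleted ls → T (V (smooth S w ls ns) y)
  smooth-vertex (symmetric , loopless , Adj⇒V) lab {y} y∈ y∉del =
    from T-∧ (Adj⇒V y w (symmetric w y wy) , from T-∧ (fromWitnessFalse {a? = y ≟ w} y≢w , ¬T⇒T-not (y∉del ∘ any==⇒∈ _)))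
    where
    wy : Adj S w y
    wy = labelled⇒Adj lab y∈
    y≢w : y ≢ w
    y≢w refl = loopless w wy

  smooth-twoVertices : IsSimple S → IsSmoothingLabelling S w ls ns → HasTwoVertices (smooth S w ls ns)
  smooth-twoVertices simple lab@(_ , unique , _ , 2≤ , _) =
    let a , b , a≢b , a∈ , b∈ , a∉ , b∉ = leadingPair (ls ++ ns) unique 2≤
    in a , b , a≢b , smooth-vertex simple lab a∈ (a∉ ∘ smoothDeleted⊆drop2 ls ns)
                   , smooth-vertex simple lab b∈ (b∉ ∘ smoothDeleted⊆drop2 ls ns)

deleteVertex-smooth-hubReduction : ∀ {n} {G : Graph n} {u v : Fin n} {ls ns : List (Fin n)} →
  IsSimple G → Adj G u v → IsSmoothingLabelling (deleteVertex G v) u ls ns →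
  HubReduction G (smooth (deleteVertex G v) u ls ns) u v
deleteVertex-smooth-hubReduction {G = G} {u} {v} {ls} {ns} (symmetric , _ , Adj⇒V) uv lab = record
  { source∈G  = Adj⇒V v u vu
  ; source~u  = vu
  ; vertices⊆ = deleteVertex-V⊆ ∘ smooth-V⊆
  ; edge      = Sum.map deleteVertex-Adj⊆ deleteVertex-Adj⊆ ∘ smooth-Adj lab
  ; cover     = cover
  }
  where
  open VertexDeletion G v
  open Smoothing (deleteVertex G v) u ls ns
  vu : Adj G v u
  vu = symmetric u v uv
  cover : ∀ {y} → T (V G y) → T (V (smooth (deleteVertex G v) u ls ns) y) ⊎ y ≡ u ⊎ Adj G u y
  cover y∈G with deleteVertex-V y∈G
  ... | inj₂ refl = inj₂ (inj₂ uv)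
  ... | inj₁ y∈S with smooth-V y∈S
  ...   | inj₁ y∈H          = inj₁ y∈H
  ...   | inj₂ (inj₁ y≡u)   = inj₂ (inj₁ y≡u)
  ...   | inj₂ (inj₂ y∈del) = inj₂ (inj₂ (deleteVertex-Adj⊆ (labelled⇒Adj lab (∈-++⁺ˡ (smoothDeleted⊆ ls y∈del)))))

lemma3 : ∀ {n} (T : Graph n) (u v : Fin n) →
    IsTree T → 3 ≤ deg T u → Adj T u v → IsLeaf T v →
    (ls ns : List (Fin n)) → IsSmoothingLabelling (deleteVertex T v) u ls ns →
    (b' : ℕ) → IsBurningNumber (smooth (deleteVertex T v) u ls ns) b' →
    (Σ (List (Fin n)) λ xs → IsBurningSequence T (v ∷ xs) × length (v ∷ xs) ≤ suc b') ×
    (∀ (b : ℕ) → IsBurningNumber T b → b ≤ suc b')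
lemma3 G u v (simple , _) _ uv _ ls ns lab _ ((_ , H-burns , refl) , _) =
  let xs , G-burns , len = burningSequence-lift (deleteVertex-smooth-hubReduction simple uv lab) H-burns
                             (burningSequence-2≤length (smooth-twoVertices (deleteVertex-simple simple) lab) H-burns)
  in (xs , G-burns , s≤s len) , λ _ (_ , minimal) → ≤-trans (minimal (v ∷ xs) G-burns) (s≤s len)
  where
  open VertexDeletion G v using (deleteVertex-simple)
  open Smoothing (deleteVertex G v) u ls ns using (smooth-twoVertices)
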